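{- Let $G$ be an eulerian graph containing a configuration $F_{s,t}$ where either $s=1$ and $t$ is even, or $s\ge 2$ and $t\ge 2$. Then $G$ has no orientable bi-eulerian embedding.
   Context: Graphs are finite and may have loops and multiple edges. A graph is eulerian if it has a circuit using every edge and vertex (an euler circuit). A chain of digons of length $k$ in $G$ consists of $k+1$ distinct vertices $v_0,v_1,\dots,v_k$, each of degree $4$ in $G$, such that $v_{i-1}$ and $v_i$ are joined by a pair of parallel edges (a digon) for $1\le i\le k$; $v_0$ is its first vertex and $v_k$ its last vertex. The configuration $F_{s,t}$ consists of two vertex-disjoint chains of digons, the first of length $s$ and the second of length $t$, such that the last vertex of the first chain is adjacent (by an edge) to both the first and the last vertices of the second chain. Embeddings are cellular in closed surfaces; a bi-eulerian embedding has exactly two faces, each bounded by an euler circuit. -}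

module Defs where

open import Data.Nat using (ℕ; zero; suc; _≤_)
open import Data.Nat.Base using (_≡ᵇ_)
open import Data.Fin using (Fin; toℕ; inject₁) renaming (suc to fsuc)
import Data.Fin as F
open import Data.Bool using (Bool; true; false; not)
open import Data.List using (List; []; _∷_; length; filter; map; allFin; cartesianProduct)
open import Data.List.Membership.Propositional using (_∈_)
open import Data.Product using (Σ; ∃; ∃-syntax; _×_; _,_; proj₁; proj₂)
open import Data.Sum using (_⊎_)
open import Relation.Nullary using (¬_)
open import Relation.Binary.PropositionalEquality using (_≡_; _≢_)
open import Function.Bundles using (_↔_; Inverse)

-- Finite graphs, loops and multiple edges allowed.
-- Vertices are Fin nV, edges are Fin nE; each edge has two ends
-- (end1, end2); a loop has end1 ≡ end2.

record Graph : Set where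
  field
    nV   : ℕ
    nE   : ℕ
    end1 : Fin nE → Fin nV
    end2 : Fin nE → Fin nV

module _ (G : Graph) where
  open Graph G

  Vertex : Set
  Vertex = Fin nV

  Edge : Set
  Edge = Fin nE

  Dart : Set
  Dart = Edge × Bool

  edgeOf : Dart → Edge
  edgeOf = proj₁

  origin : Dart → Vertex
  origin (e , false) = end1 e
  origin (e , true)  = end2 e

  terminus : Dart → Vertex
  terminus (e , false) = end2 e
  terminus (e , true)  = end1 e

  flip : Dart → Dart
  flip (e , b) = (e , not b)

  allDarts : List Dart
  allDarts = cartesianProduct (allFin nE) (false ∷ true ∷ [])

  -- degree: number of edge-ends at v (a loop contributes 2)
  degree : Vertex → ℕ
  degree v = length (filter (λ d → origin d F.≟ v) allDarts)

  Joins : Edge → Vertex → Vertex → Set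
  Joins e x y = (end1 e ≡ x × end2 e ≡ y) ⊎ (end1 e ≡ y × end2 e ≡ x)

  Adjacent : Vertex → Vertex → Set
  Adjacent x y = ∃[ e ] Joins e x y

  data Trail : List Dart → Set where
    []  : Trail []
    [_] : ∀ d → Trail (d ∷ [])
    _∷_ : ∀ {d d' ds} → terminus d ≡ origin d' → Trail (d' ∷ ds) → Trail (d ∷ d' ∷ ds)

  last? : Dart → List Dart → Dart
  last? d [] = d
  last? d (d' ∷ ds) = last? d' ds

  Closed : List Dart → Set
  Closed [] = Data.Unit.⊤ where import Data.Unit
  Closed (d ∷ ds) = terminus (last? d ds) ≡ origin d

  uses : List Dart → Edge → ℕ
  uses w e = length (filter (λ d → edgeOf d F.≟ e) w)

  IsEulerCircuit : List Dart → Set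
  IsEulerCircuit w =
    Trail w × Closed w × (∀ e → uses w e ≡ 1) ×
    (∀ v → ∃[ d ] (d ∈ w × origin d ≡ v))

  Eulerian : Set
  Eulerian = ∃[ w ] IsEulerCircuit w

  record DigonChain (k : ℕ) : Set where
    field
      vtx      : Fin (suc k) → Vertex
      distinct : ∀ i j → vtx i ≡ vtx j → i ≡ j
      deg4     : ∀ i → degree (vtx i) ≡ 4
      digon    : ∀ (i : Fin k) → ∃[ e ] ∃[ e' ] (e ≢ e' ×
                   Joins e  (vtx (inject₁ i)) (vtx (fsuc i)) ×
                   Joins e' (vtx (inject₁ i)) (vtx (fsuc i)))

    firstV : Vertex
    firstV = vtx F.zero

    lastV : Vertex
    lastV = vtx (F.fromℕ k)

  open DigonChain public

  record ConfigF (s t : ℕ) : Set where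
    field
      chain₁   : DigonChain s
      chain₂   : DigonChain t
      disjoint : ∀ i j → vtx chain₁ i ≢ vtx chain₂ j
      adjFirst : Adjacent (lastV chain₁) (firstV chain₂)
      adjLast  : Adjacent (lastV chain₁) (lastV chain₂)

  -- Orientable cellular embeddings, via rotation systems
  -- (Heffter–Edmonds).  The faces are the orbits of φ = ρ ∘ flip; the boundary
  -- walk of the face containing d is d, φ d, φ² d, … .

  iter : (Dart → Dart) → ℕ → Dart → Dart
  iter f zero    x = x
  iter f (suc k) x = f (iter f k x)

  record RotationSystem : Set where
    field
      ρ        : Dart ↔ Dart
    rot : Dart → Dart
    rot = Inverse.to ρ
    field
      local    : ∀ d → origin (rot d) ≡ origin d
      oneCycle : ∀ d d' → origin d ≡ origin d' → ∃[ k ] iter rot k d ≡ d'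

    faceStep : Dart → Dart
    faceStep d = rot (flip d)

    SameFace : Dart → Dart → Set
    SameFace d d' = ∃[ k ] iter faceStep k d ≡ d'

    FaceIsEuler : Dart → Set
    FaceIsEuler d =
      (∀ e → (SameFace d (e , false) × ¬ SameFace d (e , true))
           ⊎ (SameFace d (e , true) × ¬ SameFace d (e , false))) ×
      (∀ v → ∃[ d' ] (SameFace d d' × origin d' ≡ v))

    BiEulerian : Set
    BiEulerian = ∃[ d₁ ] ∃[ d₂ ]
      (¬ SameFace d₁ d₂ ×
       (∀ d → SameFace d₁ d ⊎ SameFace d₂ d) ×
       FaceIsEuler d₁ × FaceIsEuler d₂)

  open RotationSystem public

  HasOrientableBiEulerianEmbedding : Set
  HasOrientableBiEulerianEmbedding = ∃[ R ] BiEulerian R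

-- Call the face of a dart its side.  As both faces are euler circuits, the two darts of an
-- edge lie on different sides, so sides alternate around every vertex, and every closed
-- face walk passes through every edge: there are no short faces.  Along a chain of at least
-- two digons this forces all forward darts of the chain onto one side, since otherwise the
-- rotations near the start of the chain produce a face of length 2 or 4.  When both chains
-- are long, reading off sides at the vertex joining them is contradictory.  When the first
-- chain is a single digon, the face walk leaving it zigzags along the second chain and, the
-- length being even, comes back avoiding an edge at the start of the second chain; through
-- the single digon it then closes into a face missing that edge.

module Submission where

open import Defs
open import Data.Nat using (ℕ; zero; suc; pred; _+_; _*_; _≤_; _<_; z≤n; s≤s; _<?_; >-nonZero)
open import Data.Nat.Properties
  using (≤-refl; m≤n⇒m<n∨m≡n; <⇒≤; <⇒≱; <⇒≢; n≤1+n; 1+n≢n; +-suc; m≤n+m; m≤n⇒∃[o]m+o≡n; +-identityʳ; suc-pred)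
open import Data.Nat.Divisibility using (_∣_; divides)
open import Data.Fin using (Fin)
import Data.Fin as F
import Data.Fin.Properties as FinP
open import Data.Bool using (Bool; true; false; not)
open import Data.Bool.Properties using (not-involutive; not-injective; not-¬; ¬-not)
open import Data.List using (List; []; _∷_; length; lookup; filter; applyUpTo)
open import Data.List.Properties using (length-applyUpTo)
open import Data.List.Membership.Propositional using (_∈_)
open import Data.List.Membership.Propositional.Properties
  using (∈-lookup; ∈-filter⁺; ∈-filter⁻; ∈-cartesianProduct⁺; ∈-allFin; ∈-applyUpTo⁺)
open import Data.List.Relation.Binary.Subset.Propositional using (_⊆_)
open import Data.List.Relation.Unary.All as All using (All; []; _∷_)
open import Data.List.Relation.Unary.AllPairs using ([]; _∷_)
open import Data.List.Relation.Unary.Any using (here; there; index)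
open import Data.List.Relation.Unary.Any.Properties using (lookup-index)
open import Data.List.Relation.Unary.Unique.Propositional using (Unique)
import Data.List.Relation.Unary.Unique.Propositional.Properties as Unique
open import Data.Product using (∃-syntax; _×_; _,_; proj₁; proj₂; swap)
open import Data.Sum using (_⊎_; inj₁; inj₂; [_,_]′)
open import Data.Empty using (⊥; ⊥-elim)
open import Function.Bundles using (Injection)
open import Function.Properties.Inverse using (↔⇒↣)
open import Data.Product.Properties using (≡-dec)
import Data.Bool as Bool
open import Relation.Nullary using (¬_; Dec; yes; no)
open import Relation.Binary.PropositionalEquality

lookup-injective : ∀ {A : Set} {xs : List A} → Unique xs →
                   ∀ i j → lookup xs i ≡ lookup xs j → i ≡ j
lookup-injective (_  ∷ _) F.zero    F.zero    _  = refl
lookup-injective (x≢ ∷ _) F.zero    (F.suc j) eq = ⊥-elim (All.lookup x≢ (∈-lookup j) eq)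
lookup-injective (x≢ ∷ _) (F.suc i) F.zero    eq = ⊥-elim (All.lookup x≢ (∈-lookup i) (sym eq))
lookup-injective (_  ∷ u) (F.suc i) (F.suc j) eq = cong F.suc (lookup-injective u i j eq)

Unique-⊆⇒length≤ : ∀ {A : Set} {xs ys : List A} → Unique xs → xs ⊆ ys → length xs ≤ length ys
Unique-⊆⇒length≤ {xs = xs} {ys} u xs⊆ys = FinP.injective⇒≤ position-injective
  where
  position : Fin (length xs) → Fin (length ys)
  position i = index (xs⊆ys (∈-lookup i))

  position-injective : ∀ {i j} → position i ≡ position j → i ≡ j
  position-injective {i} {j} eq = lookup-injective u i j (begin
    lookup xs i                 ≡⟨ lookup-index (xs⊆ys (∈-lookup i)) ⟩
    lookup ys (position i)      ≡⟨ cong (lookup ys) eq ⟩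
    lookup ys (position j)      ≡⟨ lookup-index (xs⊆ys (∈-lookup j)) ⟨
    lookup xs j                 ∎)
    where open ≡-Reasoning

Unique-swap : ∀ {A : Set} {x y : A} {zs} → Unique (x ∷ y ∷ zs) → Unique (y ∷ x ∷ zs)
Unique-swap ((x≢y ∷ x≢zs) ∷ y≢zs ∷ u) = (≢-sym x≢y ∷ y≢zs) ∷ x≢zs ∷ u

module Darts (G : Graph) where
  open Graph G

  flip-involutive : ∀ d → flip G (flip G d) ≡ d
  flip-involutive (e , b) = cong (e ,_) (not-involutive b)

  flip-injective : ∀ {d d'} → flip G d ≡ flip G d' → d ≡ d'
  flip-injective {d} {d'} eq =
    trans (sym (flip-involutive d)) (trans (cong (flip G) eq) (flip-involutive d'))

  same-edge : ∀ {d d'} → edgeOf G d' ≡ edgeOf G d → d' ≡ d ⊎ d' ≡ flip G d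
  same-edge {e , false} {.e , false} refl = inj₁ refl
  same-edge {e , true}  {.e , true}  refl = inj₁ refl
  same-edge {e , false} {.e , true}  refl = inj₂ refl
  same-edge {e , true}  {.e , false} refl = inj₂ refl

  Incident : Edge G → Vertex G → Set
  Incident e u = end1 e ≡ u ⊎ end2 e ≡ u

  joins-incident₁ : ∀ {e u v} → Joins G e u v → Incident e u
  joins-incident₁ (inj₁ (p , _)) = inj₁ p
  joins-incident₁ (inj₂ (_ , q)) = inj₂ q

  joins-incident₂ : ∀ {e u v} → Joins G e u v → Incident e v
  joins-incident₂ (inj₁ (_ , q)) = inj₂ q
  joins-incident₂ (inj₂ (p , _)) = inj₁ p

  incident-joins : ∀ {e a u v} → Incident e a → Joins G e u v → a ≡ u ⊎ a ≡ v
  incident-joins (inj₁ p) (inj₁ (q , _)) = inj₁ (trans (sym p) q)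
  incident-joins (inj₁ p) (inj₂ (q , _)) = inj₂ (trans (sym p) q)
  incident-joins (inj₂ p) (inj₁ (_ , r)) = inj₂ (trans (sym p) r)
  incident-joins (inj₂ p) (inj₂ (_ , r)) = inj₁ (trans (sym p) r)

  origin-incident : ∀ d → Incident (edgeOf G d) (origin G d)
  origin-incident (e , false) = inj₁ refl
  origin-incident (e , true)  = inj₂ refl

  _≟_ : (d d' : Dart G) → Dec (d ≡ d')
  _≟_ = ≡-dec F._≟_ Bool._≟_

  -- the dart of e leaving u (junk unless e is incident with u)
  dartFrom : Edge G → Vertex G → Dart G
  dartFrom e u with end1 e F.≟ u
  ... | yes _ = (e , false)
  ... | no _  = (e , true)

  edgeOf-dartFrom : ∀ e u → edgeOf G (dartFrom e u) ≡ e
  edgeOf-dartFrom e u with end1 e F.≟ u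
  ... | yes _ = refl
  ... | no _  = refl

  origin-dartFrom : ∀ {e u} → Incident e u → origin G (dartFrom e u) ≡ u
  origin-dartFrom {e} {u} i with end1 e F.≟ u | i
  ... | yes p | _      = p
  ... | no ¬p | inj₁ p = ⊥-elim (¬p p)
  ... | no _  | inj₂ p = p

  flip-dartFrom : ∀ {e u v} → Joins G e u v → u ≢ v → flip G (dartFrom e u) ≡ dartFrom e v
  flip-dartFrom {e} {u} {v} j u≢v with end1 e F.≟ u | end1 e F.≟ v | j
  ... | yes p | yes q | _             = ⊥-elim (u≢v (trans (sym p) q))
  ... | yes _ | no _  | _             = refl
  ... | no ¬p | _     | inj₁ (p , _)  = ⊥-elim (¬p p)
  ... | no _  | yes _ | inj₂ _        = refl
  ... | no _  | no ¬q | inj₂ (q , _)  = ⊥-elim (¬q q)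

  dartFrom-cases : ∀ {d e u v} → edgeOf G d ≡ e → Joins G e u v → u ≢ v →
                   d ≡ dartFrom e u ⊎ d ≡ dartFrom e v
  dartFrom-cases {d} {e} {u} refl j u≢v with same-edge {dartFrom e u} {d} (sym (edgeOf-dartFrom e u))
  ... | inj₁ p = inj₁ p
  ... | inj₂ p = inj₂ (trans p (flip-dartFrom j u≢v))

  ∈-allDarts : ∀ d → d ∈ allDarts G
  ∈-allDarts (e , false) = ∈-cartesianProduct⁺ (∈-allFin e) (here refl)
  ∈-allDarts (e , true)  = ∈-cartesianProduct⁺ (∈-allFin e) (there (here refl))

  dartsAt : Vertex G → List (Dart G)
  dartsAt v = filter (λ d → origin G d F.≟ v) (allDarts G)

  dartsAt-unique : ∀ v → Unique (dartsAt v)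
  dartsAt-unique v = Unique.filter⁺ (λ d → origin G d F.≟ v)
    (Unique.cartesianProduct⁺ (Unique.allFin⁺ nE) (((λ ()) ∷ []) ∷ [] ∷ []))

  length≤degree : ∀ {v ds} → Unique ds → All (λ d → origin G d ≡ v) ds → length ds ≤ degree G v
  length≤degree u at = Unique-⊆⇒length≤ u (λ d∈ → ∈-filter⁺ _ (∈-allDarts _) (All.lookup at d∈))

  degree≤length : ∀ {v ds} → (∀ {d} → origin G d ≡ v → d ∈ ds) → degree G v ≤ length ds
  degree≤length {v} cover =
    Unique-⊆⇒length≤ (dartsAt-unique v)
      (λ d∈ → cover (proj₂ (∈-filter⁻ (λ d → origin G d F.≟ v) {xs = allDarts G} d∈)))

iter-suc : ∀ {G} (f : Dart G → Dart G) k d → iter G f (suc k) d ≡ iter G f k (f d)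
iter-suc f zero    d = refl
iter-suc f (suc k) d = cong f (iter-suc f k d)

module Cycle (G : Graph) (f : Dart G → Dart G) (f-injective : ∀ {d d'} → f d ≡ f d' → d ≡ d')
             {x : Dart G} {n : ℕ} (period : iter G f (suc n) x ≡ x) where

  OnCycle : Dart G → Set
  OnCycle d = ∃[ k ] (k ≤ n × iter G f k x ≡ d)

  onCycle-start : OnCycle x
  onCycle-start = zero , z≤n , refl

  onCycle-step : ∀ {d} → OnCycle d → OnCycle (f d)
  onCycle-step (k , k≤n , eq) with m≤n⇒m<n∨m≡n k≤n
  ... | inj₁ k<n  = suc k , k<n , cong f eq
  ... | inj₂ refl = zero , z≤n , trans (sym period) (cong f eq)

  onCycle-unstep : ∀ {d} → OnCycle (f d) → OnCycle d
  onCycle-unstep (zero  , _   , eq) = n , ≤-refl , f-injective (trans period eq)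
  onCycle-unstep (suc k , k<n , eq) = k , <⇒≤ k<n , f-injective eq

  onCycle-iter : ∀ j {d} → OnCycle d → OnCycle (iter G f j d)
  onCycle-iter zero    p = p
  onCycle-iter (suc j) p = onCycle-step (onCycle-iter j p)

  onCycle-uniter : ∀ j {d} → OnCycle (iter G f j d) → OnCycle d
  onCycle-uniter zero    p = p
  onCycle-uniter (suc j) p = onCycle-uniter j (onCycle-unstep p)

module Rotation {G : Graph} (R : RotationSystem G) where
  open Darts G

  rot-injective : ∀ {d d'} → rot R d ≡ rot R d' → d ≡ d'
  rot-injective = Injection.injective (↔⇒↣ (ρ R))

  rot² rot³ : Dart G → Dart G
  rot² d = rot R (rot R d)
  rot³ d = rot R (rot² d)

  origin-iter-rot : ∀ k d → origin G (iter G (rot R) k d) ≡ origin G d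
  origin-iter-rot zero    d = refl
  origin-iter-rot (suc k) d = trans (local R _) (origin-iter-rot k d)

  degree≤period : ∀ {n a} → iter G (rot R) (suc n) a ≡ a → degree G (origin G a) ≤ suc n
  degree≤period {n} {a} period =
    subst (degree G (origin G a) ≤_) (length-applyUpTo orbit (suc n)) (degree≤length inOrbit)
    where
    orbit : ℕ → Dart G
    orbit k = iter G (rot R) k a

    open Cycle G (rot R) rot-injective {a} {n} period

    inOrbit : ∀ {d} → origin G d ≡ origin G a → d ∈ applyUpTo orbit (suc n)
    inOrbit {d} o with oneCycle R a d (sym o)
    ... | k , refl with onCycle-iter k onCycle-start
    ...   | j , j≤n , eq = subst (_∈ _) eq (∈-applyUpTo⁺ orbit (s≤s j≤n))

  record FourCycle (v : Vertex G) (a : Dart G) : Set where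
    field
      a≢rot²a : a ≢ rot² a
      rot⁴≡id : rot R (rot³ a) ≡ a
      around  : ∀ {x} → origin G x ≡ v → x ≡ a ⊎ x ≡ rot R a ⊎ x ≡ rot² a ⊎ x ≡ rot³ a

  -- A shorter period would leave one of the four darts at v out of the orbit of a,
  -- and a fifth dart at v would exceed the degree.
  fourCycle : ∀ {v a} → degree G v ≡ 4 → origin G a ≡ v → FourCycle v a
  fourCycle {v} {a} deg4 refl = record { a≢rot²a = a≢rot²a ; rot⁴≡id = rot⁴≡id ; around = around }
    where
    short-period : ∀ n → suc n < 4 → iter G (rot R) (suc n) a ≢ a
    short-period n n<3 period = <⇒≱ n<3 (subst (_≤ suc n) deg4 (degree≤period period))

    a≢rota : a ≢ rot R a
    a≢rota eq = short-period 0 (s≤s (s≤s z≤n)) (sym eq)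
    a≢rot²a : a ≢ rot² a
    a≢rot²a eq = short-period 1 (s≤s (s≤s (s≤s z≤n))) (sym eq)
    a≢rot³a : a ≢ rot³ a
    a≢rot³a eq = short-period 2 (s≤s (s≤s (s≤s (s≤s z≤n)))) (sym eq)

    at-v : ∀ k → origin G (iter G (rot R) k a) ≡ origin G a
    at-v k = origin-iter-rot k a

    around : ∀ {x} → origin G x ≡ origin G a → x ≡ a ⊎ x ≡ rot R a ⊎ x ≡ rot² a ⊎ x ≡ rot³ a
    around {x} o with x ≟ a | x ≟ rot R a | x ≟ rot² a | x ≟ rot³ a
    ... | yes p | _     | _     | _     = inj₁ p
    ... | no _  | yes p | _     | _     = inj₂ (inj₁ p)
    ... | no _  | no _  | yes p | _     = inj₂ (inj₂ (inj₁ p))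
    ... | no _  | no _  | no _  | yes p = inj₂ (inj₂ (inj₂ p))
    ... | no x≢a | no x≢a₁ | no x≢a₂ | no x≢a₃ = ⊥-elim (<⇒≱ ≤-refl (subst (5 ≤_) deg4
          (length≤degree five-distinct (at-v 0 ∷ at-v 1 ∷ at-v 2 ∷ at-v 3 ∷ o ∷ []))))
      where
      five-distinct : Unique (a ∷ rot R a ∷ rot² a ∷ rot³ a ∷ x ∷ [])
      five-distinct =
        (a≢rota ∷ a≢rot²a ∷ a≢rot³a ∷ (λ eq → x≢a (sym eq)) ∷ []) ∷
        ((λ eq → a≢rota (rot-injective eq)) ∷ (λ eq → a≢rot²a (rot-injective eq)) ∷
           (λ eq → x≢a₁ (sym eq)) ∷ []) ∷
        ((λ eq → a≢rota (rot-injective (rot-injective eq))) ∷ (λ eq → x≢a₂ (sym eq)) ∷ []) ∷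
        ((λ eq → x≢a₃ (sym eq)) ∷ []) ∷ [] ∷ []

    rot⁴≡id : rot R (rot³ a) ≡ a
    rot⁴≡id with around (at-v 4)
    ... | inj₁ p                 = p
    ... | inj₂ (inj₁ p)          = ⊥-elim (a≢rot³a (sym (rot-injective p)))
    ... | inj₂ (inj₂ (inj₁ p))   = ⊥-elim (a≢rot²a (sym (rot-injective (rot-injective p))))
    ... | inj₂ (inj₂ (inj₂ p))   = ⊥-elim (a≢rota (sym (rot-injective (rot-injective (rot-injective p)))))

  rotation-completes : ∀ {v a P Q Q'} → FourCycle v a → Unique (a ∷ P ∷ Q ∷ Q' ∷ []) →
    rot R a ≡ P → origin G Q ≡ v → origin G Q' ≡ v →
    (rot R P ≡ Q × rot R Q ≡ Q' × rot R Q' ≡ a) ⊎ (rot R P ≡ Q' × rot R Q' ≡ Q × rot R Q ≡ a)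
  rotation-completes c ((_ ∷ a≢Q ∷ a≢Q' ∷ []) ∷ (P≢Q ∷ P≢Q' ∷ []) ∷ (Q≢Q' ∷ []) ∷ [] ∷ []) refl oQ oQ'
    with FourCycle.around c oQ | FourCycle.around c oQ'
  ... | inj₁ p                 | _                      = ⊥-elim (a≢Q (sym p))
  ... | inj₂ (inj₁ p)          | _                      = ⊥-elim (P≢Q (sym p))
  ... | _                      | inj₁ p                 = ⊥-elim (a≢Q' (sym p))
  ... | _                      | inj₂ (inj₁ p)          = ⊥-elim (P≢Q' (sym p))
  ... | inj₂ (inj₂ (inj₁ p))   | inj₂ (inj₂ (inj₁ p'))  = ⊥-elim (Q≢Q' (trans p (sym p')))
  ... | inj₂ (inj₂ (inj₂ p))   | inj₂ (inj₂ (inj₂ p'))  = ⊥-elim (Q≢Q' (trans p (sym p')))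
  ... | inj₂ (inj₂ (inj₁ p))   | inj₂ (inj₂ (inj₂ p'))  =
    inj₁ (sym p , trans (cong (rot R) p) (sym p') , trans (cong (rot R) p') (FourCycle.rot⁴≡id c))
  ... | inj₂ (inj₂ (inj₂ p))   | inj₂ (inj₂ (inj₁ p'))  =
    inj₂ (sym p' , trans (cong (rot R) p') (sym p) , trans (cong (rot R) p) (FourCycle.rot⁴≡id c))

module TwoFaces {G : Graph} (R : RotationSystem G) (bi : BiEulerian R) where
  open Darts G
  open Rotation R

  φ : Dart G → Dart G
  φ = faceStep R

  φ-injective : ∀ {d d'} → φ d ≡ φ d' → d ≡ d'
  φ-injective eq = flip-injective (rot-injective eq)

  φ-flip : ∀ d → φ (flip G d) ≡ rot R d
  φ-flip d = cong (rot R) (flip-involutive d)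

  private
    d₁ d₂ : Dart G
    d₁ = proj₁ bi
    d₂ = proj₁ (proj₂ bi)

    covered : ∀ d → SameFace R d₁ d ⊎ SameFace R d₂ d
    covered = proj₁ (proj₂ (proj₂ (proj₂ bi)))

    euler₁ : FaceIsEuler R d₁
    euler₁ = proj₁ (proj₂ (proj₂ (proj₂ (proj₂ bi))))

    euler₂ : FaceIsEuler R d₂
    euler₂ = proj₂ (proj₂ (proj₂ (proj₂ (proj₂ bi))))

  euler-¬flip : ∀ {d₀ d} → FaceIsEuler R d₀ → SameFace R d₀ d → ¬ SameFace R d₀ (flip G d)
  euler-¬flip {d = e , false} eu sd with proj₁ eu e
  ... | inj₁ (_ , ¬t) = ¬t
  ... | inj₂ (_ , ¬f) = λ _ → ¬f sd
  euler-¬flip {d = e , true}  eu sd with proj₁ eu e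
  ... | inj₁ (_ , ¬t) = λ _ → ¬t sd
  ... | inj₂ (_ , ¬f) = ¬f

  euler-meets : ∀ {d₀} → FaceIsEuler R d₀ → ∀ E → ∃[ j ] edgeOf G (iter G φ j d₀) ≡ E
  euler-meets eu E with proj₁ eu E
  ... | inj₁ ((j , eq) , _) = j , cong proj₁ eq
  ... | inj₂ ((j , eq) , _) = j , cong proj₁ eq

  faces-disjoint : ∀ {d} → SameFace R d₁ d → SameFace R d₂ d → ⊥
  faces-disjoint {d} s₁ s₂ with covered (flip G d)
  ... | inj₁ t = euler-¬flip euler₁ s₁ t
  ... | inj₂ t = euler-¬flip euler₂ s₂ t

  side : Dart G → Bool
  side d with covered d
  ... | inj₁ _ = true
  ... | inj₂ _ = false

  side-face₁ : ∀ {d} → SameFace R d₁ d → side d ≡ true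
  side-face₁ {d} s with covered d
  ... | inj₁ _ = refl
  ... | inj₂ t = ⊥-elim (faces-disjoint s t)

  side-face₂ : ∀ {d} → SameFace R d₂ d → side d ≡ false
  side-face₂ {d} s with covered d
  ... | inj₁ t = ⊥-elim (faces-disjoint t s)
  ... | inj₂ _ = refl

  side-φ : ∀ d → side (φ d) ≡ side d
  side-φ d with covered d
  ... | inj₁ (k , eq) = side-face₁ (suc k , cong φ eq)
  ... | inj₂ (k , eq) = side-face₂ (suc k , cong φ eq)

  side-flip : ∀ d → side (flip G d) ≡ not (side d)
  side-flip d with covered d | covered (flip G d)
  ... | inj₁ s | inj₁ t = ⊥-elim (euler-¬flip euler₁ s t)
  ... | inj₁ _ | inj₂ _ = refl
  ... | inj₂ _ | inj₁ _ = refl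
  ... | inj₂ s | inj₂ t = ⊥-elim (euler-¬flip euler₂ s t)

  side-unflip : ∀ d → side d ≡ not (side (flip G d))
  side-unflip d = trans (sym (not-involutive (side d))) (cong not (sym (side-flip d)))

  opposite-sides-flip : ∀ {d d'} → side d' ≡ not (side d) → side (flip G d') ≡ not (side (flip G d))
  opposite-sides-flip {d} {d'} s = trans (side-flip d') (cong not (trans s (sym (side-flip d))))

  side-rot : ∀ d → side (rot R d) ≡ not (side d)
  side-rot d = begin
    side (rot R d)             ≡⟨ cong (λ d' → side (rot R d')) (flip-involutive d) ⟨
    side (φ (flip G d))        ≡⟨ side-φ (flip G d) ⟩
    side (flip G d)            ≡⟨ side-flip d ⟩
    not (side d)               ∎
    where open ≡-Reasoning

  side-rot² : ∀ d → side (rot² d) ≡ side d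
  side-rot² d = trans (side-rot (rot R d)) (trans (cong not (side-rot d)) (not-involutive (side d)))

  closed-face-walk-meets : ∀ {X N} → iter G φ (suc N) X ≡ X →
                           ∀ E → ∃[ k ] (k ≤ N × edgeOf G (iter G φ k X) ≡ E)
  closed-face-walk-meets {X} {N} period E = [ via euler₁ , via euler₂ ]′ (covered X)
    where
    open Cycle G φ φ-injective {X} {N} period

    via : ∀ {d₀} → FaceIsEuler R d₀ → SameFace R d₀ X → ∃[ k ] (k ≤ N × edgeOf G (iter G φ k X) ≡ E)
    via eu (m , eq) with euler-meets eu E
    ... | j , e with onCycle-iter j (onCycle-uniter m (subst OnCycle (sym eq) onCycle-start))
    ...   | k , k≤N , eqk = k , k≤N , trans (cong (edgeOf G) eqk) e

  no-face-of-length-2 : ∀ {X₀ X₁} E → φ X₀ ≡ X₁ → φ X₁ ≡ X₀ →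
                        edgeOf G X₀ ≢ E → edgeOf G X₁ ≢ E → ⊥
  no-face-of-length-2 {X₀} E e₀₁ e₁₀ n₀ n₁ =
    avoid (closed-face-walk-meets {N = 1} (trans (cong φ e₀₁) e₁₀) E)
    where
    avoid : ∃[ k ] (k ≤ 1 × edgeOf G (iter G φ k X₀) ≡ E) → ⊥
    avoid (zero        , _ , e)  = n₀ e
    avoid (suc zero    , _ , e)  = n₁ (trans (cong (edgeOf G) (sym e₀₁)) e)
    avoid (suc (suc _) , s≤s () , _)

  no-face-of-length-4 : ∀ {X₀ X₁ X₂ X₃} E → φ X₀ ≡ X₁ → φ X₁ ≡ X₂ → φ X₂ ≡ X₃ → φ X₃ ≡ X₀ →
                        edgeOf G X₀ ≢ E → edgeOf G X₁ ≢ E → edgeOf G X₂ ≢ E → edgeOf G X₃ ≢ E → ⊥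
  no-face-of-length-4 {X₀} {X₁} {X₂} {X₃} E e₀₁ e₁₂ e₂₃ e₃₀ n₀ n₁ n₂ n₃ =
    avoid (closed-face-walk-meets {N = 3} (trans (cong φ e₀₃) e₃₀) E)
    where
    e₀₂ : φ (φ X₀) ≡ X₂
    e₀₂ = trans (cong φ e₀₁) e₁₂
    e₀₃ : φ (φ (φ X₀)) ≡ X₃
    e₀₃ = trans (cong φ e₀₂) e₂₃

    avoid : ∃[ k ] (k ≤ 3 × edgeOf G (iter G φ k X₀) ≡ E) → ⊥
    avoid (zero                 , _ , e) = n₀ e
    avoid (suc zero             , _ , e) = n₁ (trans (cong (edgeOf G) (sym e₀₁)) e)
    avoid (suc (suc zero)       , _ , e) = n₂ (trans (cong (edgeOf G) (sym e₀₂)) e)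
    avoid (suc (suc (suc zero)) , _ , e) = n₃ (trans (cong (edgeOf G) (sym e₀₃)) e)
    avoid (suc (suc (suc (suc _))) , s≤s (s≤s (s≤s ())) , _)

  WalkAvoids : Edge G → ℕ → Dart G → Set
  WalkAvoids Z n P = ∀ k → k ≤ n → edgeOf G (iter G φ k P) ≢ Z

  walkAvoids-extend : ∀ {Z n P} → WalkAvoids Z n P → edgeOf G (iter G φ (suc n) P) ≢ Z →
                      WalkAvoids Z (suc n) P
  walkAvoids-extend avoids last k k≤ with m≤n⇒m<n∨m≡n k≤
  ... | inj₁ (s≤s k≤n) = avoids k k≤n
  ... | inj₂ refl      = last

  no-closed-avoiding-walk : ∀ {Z n P} → iter G φ (suc n) P ≡ P → WalkAvoids Z n P → ⊥
  no-closed-avoiding-walk {Z} period avoids with closed-face-walk-meets period Z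
  ... | k , k≤n , e = avoids k k≤n e

  module DegreeFour {v} (deg4 : degree G v ≡ 4) {a} (oa : origin G a ≡ v) where
    open FourCycle (fourCycle {v} {a} deg4 oa)

    private
      side-rot³ : side (rot³ a) ≡ not (side a)
      side-rot³ = trans (side-rot (rot² a)) (cong not (side-rot² a))

    opposite : ∀ {a'} → origin G a' ≡ v → a' ≢ a → side a' ≡ side a → a' ≡ rot² a
    opposite o a'≢a s with around o
    ... | inj₁ p               = ⊥-elim (a'≢a p)
    ... | inj₂ (inj₁ p)        = ⊥-elim (not-¬ s (trans (cong side p) (side-rot a)))
    ... | inj₂ (inj₂ (inj₁ p)) = p
    ... | inj₂ (inj₂ (inj₂ p)) = ⊥-elim (not-¬ s (trans (cong side p) side-rot³))

    adjacent : ∀ {a'} → origin G a' ≡ v → side a' ≡ not (side a) → a' ≡ rot R a ⊎ rot R a' ≡ a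
    adjacent o s with around o
    ... | inj₁ p               = ⊥-elim (not-¬ (cong side p) s)
    ... | inj₂ (inj₁ p)        = inj₁ p
    ... | inj₂ (inj₂ (inj₁ p)) = ⊥-elim (not-¬ (trans (cong side p) (side-rot² a)) s)
    ... | inj₂ (inj₂ (inj₂ p)) = inj₂ (trans (cong (rot R) p) rot⁴≡id)

    other-side : ∀ {a' b} → origin G a' ≡ v → origin G b ≡ v → a' ≢ a → side a' ≡ side a →
                 b ≢ a → b ≢ a' → side b ≡ not (side a)
    other-side oa' ob a'≢a s b≢a b≢a' with opposite oa' a'≢a s | around ob
    ... | _ | inj₁ p               = ⊥-elim (b≢a p)
    ... | _ | inj₂ (inj₁ p)        = trans (cong side p) (side-rot a)
    ... | e | inj₂ (inj₂ (inj₁ p)) = ⊥-elim (b≢a' (trans p (sym e)))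
    ... | _ | inj₂ (inj₂ (inj₂ p)) = trans (cong side p) side-rot³

  -- Here p, p' run from u to v and q, q' from v to w, and the rotation at v is p, p', q, q'.
  -- Whichever way the rotations at u and w go, some face has length 2 or 4.
  no-unbalanced-digon-pair : ∀ {u w p p' q q'} X → degree G u ≡ 4 → degree G w ≡ 4 →
    origin G (flip G p) ≡ u → origin G (flip G p') ≡ u →
    origin G (flip G q) ≡ w → origin G (flip G q') ≡ w →
    side (flip G p') ≡ not (side (flip G p)) → side (flip G q') ≡ not (side (flip G q)) →
    rot R p ≡ p' → rot R p' ≡ q → rot R q ≡ q' → rot R q' ≡ p →
    edgeOf G p ≢ X → edgeOf G p' ≢ X → edgeOf G q ≢ X → edgeOf G q' ≢ X → ⊥
  no-unbalanced-digon-pair {p = p} {p'} {q} {q'} X deg-u deg-w op op' oq oq' sp sq r₁ r₂ r₃ r₄ np np' nq nq'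
    with DegreeFour.adjacent deg-u op op' sp
  ... | inj₂ r = no-face-of-length-2 X (trans (φ-flip p) r₁) r np np'
  ... | inj₁ r with DegreeFour.adjacent deg-w oq oq' sq
  ...   | inj₂ r' = no-face-of-length-2 X (trans (φ-flip q) r₃) r' nq nq'
  ...   | inj₁ r' = no-face-of-length-4 X (trans (φ-flip p') r₂) (sym r') (trans (φ-flip q') r₄) (sym r)
                      np' nq nq' np

  -- Either the walk from P closes up after three more steps, or a face of length 2 appears.
  no-avoiding-return-through-digon : ∀ {v₀ P Q A B Z n} → degree G v₀ ≡ 4 →
    rot R Q ≡ A → rot R A ≡ B → rot R B ≡ P →
    origin G (flip G A) ≡ v₀ → origin G (flip G B) ≡ v₀ →
    iter G φ n P ≡ flip G Q → WalkAvoids Z n P → edgeOf G A ≢ Z → edgeOf G B ≢ Z → ⊥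
  no-avoiding-return-through-digon {P = P} {Q} {A} {B} {Z} {n} deg₀ h₁ h₂ h₃ oA oB walk avoids zA zB
    with DegreeFour.adjacent deg₀ oA oB sB
    where
    open ≡-Reasoning
    sB : side (flip G B) ≡ not (side (flip G A))
    sB = begin
      side (flip G B)          ≡⟨ side-flip B ⟩
      not (side B)             ≡⟨ cong (λ d → not (side d)) h₂ ⟨
      not (side (rot R A))     ≡⟨ cong not (side-rot A) ⟩
      not (not (side A))       ≡⟨ cong not (side-flip A) ⟨
      not (side (flip G A))    ∎
  ... | inj₂ r = no-face-of-length-2 Z r (trans (φ-flip A) h₂) zB zA
  ... | inj₁ r = no-closed-avoiding-walk e₃
                   (walkAvoids-extend (walkAvoids-extend avoids (λ e → zA (trans (cong (edgeOf G) (sym e₁)) e)))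
                                      (λ e → zB (trans (cong (edgeOf G) (sym e₂)) e)))
    where
    e₁ : iter G φ (suc n) P ≡ A
    e₁ = trans (cong φ walk) (trans (φ-flip Q) h₁)
    e₂ : iter G φ (suc (suc n)) P ≡ flip G B
    e₂ = trans (cong φ e₁) (sym r)
    e₃ : iter G φ (suc (suc (suc n))) P ≡ P
    e₃ = trans (cong φ e₂) (trans (φ-flip B) h₃)

  no-avoiding-return : ∀ {v₁ v₀ P Q a b Z n} → degree G v₁ ≡ 4 → degree G v₀ ≡ 4 →
    Unique (P ∷ Q ∷ a ∷ b ∷ []) → All (λ d → origin G d ≡ v₁) (P ∷ Q ∷ a ∷ b ∷ []) →
    origin G (flip G a) ≡ v₀ → origin G (flip G b) ≡ v₀ →
    side Q ≡ not (side P) → iter G φ n P ≡ flip G Q →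
    WalkAvoids Z n P → edgeOf G a ≢ Z → edgeOf G b ≢ Z → ⊥
  no-avoiding-return {P = P} {Q} {a} {b} {Z} {n} deg₁ deg₀ distinct
    (oP ∷ oQ ∷ oa ∷ ob ∷ []) oa₀ ob₀ sQ walk avoids za zb
    with DegreeFour.adjacent deg₁ oP oQ sQ
  ... | inj₂ r = no-closed-avoiding-walk (trans (cong φ walk) (trans (φ-flip Q) r)) avoids
  ... | inj₁ r with rotation-completes (fourCycle deg₁ oP) distinct (sym r) oa ob
  ...   | inj₁ (h₁ , h₂ , h₃) = no-avoiding-return-through-digon deg₀ h₁ h₂ h₃ oa₀ ob₀ walk avoids za zb
  ...   | inj₂ (h₁ , h₂ , h₃) = no-avoiding-return-through-digon deg₀ h₁ h₂ h₃ ob₀ oa₀ walk avoids zb za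

extend : ∀ {A : Set} {n} → A → (Fin n → A) → ℕ → A
extend {n = n} junk f i with i <? n
... | yes i<n = f (F.fromℕ< i<n)
... | no _    = junk

extend-fromℕ< : ∀ {A : Set} {n} (junk : A) (f : Fin n → A) {i} (i<n : i < n) →
                extend junk f i ≡ f (F.fromℕ< i<n)
extend-fromℕ< {n = n} junk f {i} i<n with i <? n
... | yes _  = refl
... | no i≮n = ⊥-elim (i≮n i<n)

extend-image : ∀ {A : Set} {n} (x : Fin (suc n) → A) i → ∃[ j ] extend (x F.zero) x i ≡ x j
extend-image {n = n} x i with i <? suc n
... | yes i<n = F.fromℕ< i<n , refl
... | no _    = F.zero , refl

-- A digon chain indexed by ℕ; beyond the chain the vertices and edges are junk.
record DigonPath (G : Graph) (t : ℕ) : Set where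
  field
    vertex           : ℕ → Vertex G
    vertex-injective : ∀ {i j} → i ≤ t → j ≤ t → vertex i ≡ vertex j → i ≡ j
    degree-vertex    : ∀ {i} → i ≤ t → degree G (vertex i) ≡ 4
    edge edge'       : ℕ → Edge G
    edge≢edge'       : ∀ {k} → k < t → edge k ≢ edge' k
    edge-joins       : ∀ {k} → k < t → Joins G (edge k) (vertex k) (vertex (suc k))
    edge'-joins      : ∀ {k} → k < t → Joins G (edge' k) (vertex k) (vertex (suc k))

module _ {G : Graph} {t : ℕ} (C : DigonChain G t) (junk : Edge G) where

  private
    vertex : ℕ → Vertex G
    vertex = extend (firstV C) (vtx C)

    vertex-fromℕ< : ∀ {i} (i≤t : i ≤ t) → vertex i ≡ vtx C (F.fromℕ< (s≤s i≤t))
    vertex-fromℕ< i≤t = extend-fromℕ< (firstV C) (vtx C) (s≤s i≤t)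

    inject₁-fromℕ< : ∀ {k} (k<t : k < t) → F.inject₁ (F.fromℕ< k<t) ≡ F.fromℕ< (s≤s (<⇒≤ k<t))
    inject₁-fromℕ< k<t = FinP.toℕ-injective
      (trans (FinP.toℕ-inject₁ _) (trans (FinP.toℕ-fromℕ< k<t) (sym (FinP.toℕ-fromℕ< (s≤s (<⇒≤ k<t))))))

    edge edge' : ℕ → Edge G
    edge  = extend junk (λ i → proj₁ (digon C i))
    edge' = extend junk (λ i → proj₁ (proj₂ (digon C i)))

    digonℕ : ∀ {k} → k < t → edge k ≢ edge' k × Joins G (edge k) (vertex k) (vertex (suc k)) ×
                              Joins G (edge' k) (vertex k) (vertex (suc k))
    digonℕ {k} k<t
      rewrite extend-fromℕ< junk (λ i → proj₁ (digon C i)) k<t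
            | extend-fromℕ< junk (λ i → proj₁ (proj₂ (digon C i))) k<t
            | vertex-fromℕ< (<⇒≤ k<t) | vertex-fromℕ< k<t | sym (inject₁-fromℕ< k<t)
      = proj₂ (proj₂ (digon C (F.fromℕ< k<t)))

  toDigonPath : DigonPath G t
  toDigonPath = record
    { vertex           = vertex
    ; vertex-injective = λ i≤t j≤t eq → FinP.fromℕ<-injective _ _ (s≤s i≤t) (s≤s j≤t)
        (distinct C _ _ (trans (sym (vertex-fromℕ< i≤t)) (trans eq (vertex-fromℕ< j≤t))))
    ; degree-vertex    = λ i≤t → trans (cong (degree G) (vertex-fromℕ< i≤t)) (deg4 C _)
    ; edge             = edge
    ; edge'            = edge'
    ; edge≢edge'       = λ k<t → proj₁ (digonℕ k<t)
    ; edge-joins       = λ k<t → proj₁ (proj₂ (digonℕ k<t))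
    ; edge'-joins      = λ k<t → proj₂ (proj₂ (digonℕ k<t))
    }

  toDigonPath-first : DigonPath.vertex toDigonPath 0 ≡ firstV C
  toDigonPath-first = vertex-fromℕ< z≤n

  toDigonPath-last : DigonPath.vertex toDigonPath t ≡ lastV C
  toDigonPath-last = trans (vertex-fromℕ< ≤-refl) (cong (vtx C) (sym (FinP.fromℕ-def t)))

  toDigonPath-vertex : ∀ i → ∃[ j ] DigonPath.vertex toDigonPath i ≡ vtx C j
  toDigonPath-vertex = extend-image (vtx C)

module PathDarts {G : Graph} {t : ℕ} (C : DigonPath G t) where
  open Darts G
  open DigonPath C public

  fwd fwd' bwd bwd' : ℕ → Dart G
  fwd  k = dartFrom (edge k)  (vertex k)
  fwd' k = dartFrom (edge' k) (vertex k)
  bwd  k = dartFrom (edge k)  (vertex (suc k))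
  bwd' k = dartFrom (edge' k) (vertex (suc k))

  vertex≢next : ∀ {k} → k < t → vertex k ≢ vertex (suc k)
  vertex≢next k<t eq = 1+n≢n (sym (vertex-injective (<⇒≤ k<t) k<t eq))

  flip-fwd : ∀ {k} → k < t → flip G (fwd k) ≡ bwd k
  flip-fwd k<t = flip-dartFrom (edge-joins k<t) (vertex≢next k<t)

  flip-fwd' : ∀ {k} → k < t → flip G (fwd' k) ≡ bwd' k
  flip-fwd' k<t = flip-dartFrom (edge'-joins k<t) (vertex≢next k<t)

  flip-bwd : ∀ {k} → k < t → flip G (bwd k) ≡ fwd k
  flip-bwd k<t = trans (cong (flip G) (sym (flip-fwd k<t))) (flip-involutive _)

  flip-bwd' : ∀ {k} → k < t → flip G (bwd' k) ≡ fwd' k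
  flip-bwd' k<t = trans (cong (flip G) (sym (flip-fwd' k<t))) (flip-involutive _)

  origin-fwd : ∀ {k} → k < t → origin G (fwd k) ≡ vertex k
  origin-fwd k<t = origin-dartFrom (joins-incident₁ (edge-joins k<t))

  origin-fwd' : ∀ {k} → k < t → origin G (fwd' k) ≡ vertex k
  origin-fwd' k<t = origin-dartFrom (joins-incident₁ (edge'-joins k<t))

  origin-bwd : ∀ {k} → k < t → origin G (bwd k) ≡ vertex (suc k)
  origin-bwd k<t = origin-dartFrom (joins-incident₂ (edge-joins k<t))

  origin-bwd' : ∀ {k} → k < t → origin G (bwd' k) ≡ vertex (suc k)
  origin-bwd' k<t = origin-dartFrom (joins-incident₂ (edge'-joins k<t))

  OffChain : Edge G → Set
  OffChain e = ∀ {k} → k < t → edge k ≢ e × edge' k ≢ e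

  offChain-dart : ∀ {d u} → origin G d ≡ u → (∀ i → vertex i ≢ u) → OffChain (edgeOf G d)
  offChain-dart {d} od away k<t = not-joining (edge-joins k<t) , not-joining (edge'-joins k<t)
    where
    not-joining : ∀ {e} → Joins G e (vertex _) (vertex (suc _)) → e ≢ edgeOf G d
    not-joining j refl = [ (λ p → away _ (trans (sym p) od)) , (λ p → away _ (trans (sym p) od)) ]′
                           (incident-joins (origin-incident d) j)

  offChain-dartFrom : ∀ {e k} → OffChain e → k < t → ∀ u →
                      edgeOf G (dartFrom (edge k) u) ≢ e × edgeOf G (dartFrom (edge' k) u) ≢ e
  offChain-dartFrom off k<t u =
    (λ eq → proj₁ (off k<t) (trans (sym (edgeOf-dartFrom _ u)) eq)) ,
    (λ eq → proj₂ (off k<t) (trans (sym (edgeOf-dartFrom _ u)) eq))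

  offChain-≢ : ∀ {d k} → OffChain (edgeOf G d) → k < t → ∀ u →
               d ≢ dartFrom (edge k) u × d ≢ dartFrom (edge' k) u
  offChain-≢ off k<t u =
    (λ eq → proj₁ (offChain-dartFrom off k<t u) (cong (edgeOf G) (sym eq))) ,
    (λ eq → proj₂ (offChain-dartFrom off k<t u) (cong (edgeOf G) (sym eq)))

  fwd≢fwd' : ∀ {k} → k < t → fwd k ≢ fwd' k
  fwd≢fwd' k<t eq = edge≢edge' k<t
    (trans (sym (edgeOf-dartFrom _ _)) (trans (cong (edgeOf G) eq) (edgeOf-dartFrom _ _)))

  bwd≢bwd' : ∀ {k} → k < t → bwd k ≢ bwd' k
  bwd≢bwd' k<t eq = edge≢edge' k<t
    (trans (sym (edgeOf-dartFrom _ _)) (trans (cong (edgeOf G) eq) (edgeOf-dartFrom _ _)))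

  origin-flip-fwd : ∀ {k} → k < t → origin G (flip G (fwd k)) ≡ vertex (suc k)
  origin-flip-fwd k<t = trans (cong (origin G) (flip-fwd k<t)) (origin-bwd k<t)

  origin-flip-fwd' : ∀ {k} → k < t → origin G (flip G (fwd' k)) ≡ vertex (suc k)
  origin-flip-fwd' k<t = trans (cong (origin G) (flip-fwd' k<t)) (origin-bwd' k<t)

  origin-flip-bwd : ∀ {k} → k < t → origin G (flip G (bwd k)) ≡ vertex k
  origin-flip-bwd k<t = trans (cong (origin G) (flip-bwd k<t)) (origin-fwd k<t)

  origin-flip-bwd' : ∀ {k} → k < t → origin G (flip G (bwd' k)) ≡ vertex k
  origin-flip-bwd' k<t = trans (cong (origin G) (flip-bwd' k<t)) (origin-fwd' k<t)

  interior-distinct : ∀ {k} → suc k < t → Unique (bwd k ∷ bwd' k ∷ fwd (suc k) ∷ fwd' (suc k) ∷ [])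
  interior-distinct {k} k+1<t =
    (bwd≢bwd' k<t ∷ b≢f (origin-flip-bwd k<t) (origin-flip-fwd k+1<t) ∷
                    b≢f (origin-flip-bwd k<t) (origin-flip-fwd' k+1<t) ∷ []) ∷
    (b≢f (origin-flip-bwd' k<t) (origin-flip-fwd k+1<t) ∷
     b≢f (origin-flip-bwd' k<t) (origin-flip-fwd' k+1<t) ∷ []) ∷
    (fwd≢fwd' k+1<t ∷ []) ∷ [] ∷ []
    where
    k<t : k < t
    k<t = <⇒≤ k+1<t

    b≢f : ∀ {b f} → origin G (flip G b) ≡ vertex k → origin G (flip G f) ≡ vertex (suc (suc k)) → b ≢ f
    b≢f ob of refl = <⇒≢ (s≤s (n≤1+n k)) (vertex-injective (<⇒≤ k<t) k+1<t (trans (sym ob) of))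

module ChainSides {G : Graph} (R : RotationSystem G) (bi : BiEulerian R) {t : ℕ} (C : DigonPath G t) where
  open Darts G
  open Rotation R
  open TwoFaces R bi
  open PathDarts C

  side-bwd : ∀ {k} → k < t → side (bwd k) ≡ not (side (fwd k))
  side-bwd k<t = trans (cong side (sym (flip-fwd k<t))) (side-flip _)

  side-bwd' : ∀ {k} → k < t → side (bwd' k) ≡ not (side (fwd' k))
  side-bwd' k<t = trans (cong side (sym (flip-fwd' k<t))) (side-flip _)

  forward-step : ∀ {k} → suc k < t → side (fwd' k) ≡ side (fwd k) →
                 side (fwd (suc k)) ≡ side (fwd k) × side (fwd' (suc k)) ≡ side (fwd k)
  forward-step {k} k+1<t balanced with interior-distinct k+1<t
  ... | (b≢b' ∷ b≢f ∷ b≢f' ∷ []) ∷ (b'≢f ∷ b'≢f' ∷ []) ∷ _ =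
    across (other-side (origin-fwd k+1<t) (≢-sym b≢f) (≢-sym b'≢f)) ,
    across (other-side (origin-fwd' k+1<t) (≢-sym b≢f') (≢-sym b'≢f'))
    where
    k<t : k < t
    k<t = <⇒≤ k+1<t

    same : side (bwd' k) ≡ side (bwd k)
    same = trans (side-bwd' k<t) (trans (cong not balanced) (sym (side-bwd k<t)))

    other-side : ∀ {d} → origin G d ≡ vertex (suc k) → d ≢ bwd k → d ≢ bwd' k → side d ≡ not (side (bwd k))
    other-side od n n' = DegreeFour.other-side (degree-vertex k<t) (origin-bwd k<t)
                           (origin-bwd' k<t) od (≢-sym b≢b') same n n'

    across : ∀ {d} → side d ≡ not (side (bwd k)) → side d ≡ side (fwd k)
    across s = trans s (trans (cong not (side-bwd k<t)) (not-involutive _))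

  backward-step : ∀ {k} → suc k < t → side (fwd' (suc k)) ≡ side (fwd (suc k)) →
                  side (fwd k) ≡ side (fwd (suc k)) × side (fwd' k) ≡ side (fwd (suc k))
  backward-step {k} k+1<t balanced with interior-distinct k+1<t
  ... | (b≢b' ∷ b≢f ∷ b≢f' ∷ []) ∷ (b'≢f ∷ b'≢f' ∷ []) ∷ (f≢f' ∷ []) ∷ _ =
    not-injective (trans (sym (side-bwd k<t)) (other-side (origin-bwd k<t) b≢f b≢f')) ,
    not-injective (trans (sym (side-bwd' k<t)) (other-side (origin-bwd' k<t) b'≢f b'≢f'))
    where
    k<t : k < t
    k<t = <⇒≤ k+1<t

    other-side : ∀ {d} → origin G d ≡ vertex (suc k) → d ≢ fwd (suc k) → d ≢ fwd' (suc k) →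
                 side d ≡ not (side (fwd (suc k)))
    other-side od n n' = DegreeFour.other-side (degree-vertex k<t) (origin-fwd k+1<t)
                           (origin-fwd' k+1<t) od (≢-sym f≢f') balanced n n'

  ¬unbalanced-start : ∀ X → 1 < t → OffChain X →
                      side (fwd' 0) ≢ side (fwd 0) → side (fwd' 1) ≢ side (fwd 1) → ⊥
  ¬unbalanced-start X 1<t off ¬bal₀ ¬bal₁ =
    [ (λ r → close (interior-distinct 1<t) (origin-bwd 0<t) ob ob' split₀ nb nb' (sym r))
    , (λ r → close (Unique-swap (interior-distinct 1<t)) (origin-bwd' 0<t) ob' ob split₀' nb' nb r)
    ]′ (DegreeFour.adjacent (degree-vertex 0<t) (origin-bwd 0<t) (origin-bwd' 0<t) split₁)
    where
    0<t : 0 < t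
    0<t = <⇒≤ 1<t

    ob  = origin-flip-bwd 0<t
    ob' = origin-flip-bwd' 0<t
    nb  = proj₁ (offChain-dartFrom off 0<t (vertex 1))
    nb' = proj₂ (offChain-dartFrom off 0<t (vertex 1))
    nf  = proj₁ (offChain-dartFrom off 1<t (vertex 1))
    nf' = proj₂ (offChain-dartFrom off 1<t (vertex 1))

    across : ∀ {d d' b b'} → flip G d ≡ b → flip G d' ≡ b' → side d' ≢ side d → side b' ≡ not (side b)
    across refl refl ne = opposite-sides-flip (¬-not ne)

    split₁ : side (bwd' 0) ≡ not (side (bwd 0))
    split₁ = across (flip-fwd 0<t) (flip-fwd' 0<t) ¬bal₀

    split₀ : side (flip G (bwd' 0)) ≡ not (side (flip G (bwd 0)))
    split₀ = opposite-sides-flip split₁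

    split₀' : side (flip G (bwd 0)) ≡ not (side (flip G (bwd' 0)))
    split₀' = opposite-sides-flip (across (flip-fwd' 0<t) (flip-fwd 0<t) (≢-sym ¬bal₀))

    close : ∀ {p p'} → Unique (p ∷ p' ∷ fwd 1 ∷ fwd' 1 ∷ []) → origin G p ≡ vertex 1 →
            origin G (flip G p) ≡ vertex 0 → origin G (flip G p') ≡ vertex 0 →
            side (flip G p') ≡ not (side (flip G p)) → edgeOf G p ≢ X → edgeOf G p' ≢ X → rot R p ≡ p' → ⊥
    close u op fp fp' sp np np' r
      with rotation-completes (fourCycle (degree-vertex 0<t) op) u r (origin-fwd 1<t) (origin-fwd' 1<t)
    ... | inj₁ (h₂ , h₃ , h₄) = no-unbalanced-digon-pair X (degree-vertex z≤n) (degree-vertex 1<t)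
                                  fp fp' (origin-flip-fwd 1<t) (origin-flip-fwd' 1<t) sp
                                  (opposite-sides-flip (¬-not ¬bal₁)) r h₂ h₃ h₄ np np' nf nf'
    ... | inj₂ (h₂ , h₃ , h₄) = no-unbalanced-digon-pair X (degree-vertex z≤n) (degree-vertex 1<t)
                                  fp fp' (origin-flip-fwd' 1<t) (origin-flip-fwd 1<t) sp
                                  (opposite-sides-flip (¬-not (≢-sym ¬bal₁))) r h₂ h₃ h₄ np np' nf' nf

  module Uniform (1<t : 1 < t) {X : Edge G} (X-off : OffChain X) where

    c : Bool
    c = side (fwd 0)

    private
      balanced₀ : side (fwd' 0) ≡ side (fwd 0)
      balanced₀ with side (fwd' 0) Bool.≟ side (fwd 0)
      ... | yes bal = bal
      ... | no ¬bal = ⊥-elim (¬unbalanced-start X 1<t X-off ¬bal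
                        (λ bal₁ → ¬bal (let (s , s') = backward-step 1<t bal₁ in trans s' (sym s))))

    forward-sides : ∀ {k} → k < t → side (fwd k) ≡ c × side (fwd' k) ≡ c
    forward-sides {zero}  _      = refl , balanced₀
    forward-sides {suc k} k+1<t with forward-sides (<⇒≤ k+1<t)
    ... | s , s' with forward-step k+1<t (trans s' (sym s))
    ...   | f , f' = trans f s , trans f' s

    backward-sides : ∀ {k} → k < t → side (bwd k) ≡ not c × side (bwd' k) ≡ not c
    backward-sides k<t = trans (side-bwd k<t) (cong not (proj₁ (forward-sides k<t))) ,
                         trans (side-bwd' k<t) (cong not (proj₂ (forward-sides k<t)))

    beside-forward : ∀ {k d} → k < t → origin G d ≡ vertex k → d ≢ fwd k → d ≢ fwd' k → side d ≡ not c
    beside-forward k<t od n n' =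
      trans (DegreeFour.other-side (degree-vertex (<⇒≤ k<t)) (origin-fwd k<t) (origin-fwd' k<t) od
               (≢-sym (fwd≢fwd' k<t)) (trans s' (sym s)) n n')
            (cong not s)
      where
      s  = proj₁ (forward-sides k<t)
      s' = proj₂ (forward-sides k<t)

    beside-backward : ∀ {k d} → k < t → origin G d ≡ vertex (suc k) → d ≢ bwd k → d ≢ bwd' k → side d ≡ c
    beside-backward k<t od n n' =
      trans (DegreeFour.other-side (degree-vertex k<t) (origin-bwd k<t) (origin-bwd' k<t) od
               (≢-sym (bwd≢bwd' k<t)) (trans s' (sym s)) n n')
            (trans (cong not s) (not-involutive c))
      where
      s  = proj₁ (backward-sides k<t)
      s' = proj₂ (backward-sides k<t)

    forward-cases : ∀ {k d} → k < t → origin G d ≡ vertex k → side d ≡ c → d ≡ fwd k ⊎ d ≡ fwd' k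
    forward-cases {k} {d} k<t od sd with d ≟ fwd k | d ≟ fwd' k
    ... | yes p | _     = inj₁ p
    ... | no _  | yes p = inj₂ p
    ... | no n  | no n' = ⊥-elim (not-¬ sd (beside-forward k<t od n n'))

    backward-cases : ∀ {k d} → k < t → origin G d ≡ vertex (suc k) → side d ≡ not c → d ≡ bwd k ⊎ d ≡ bwd' k
    backward-cases {k} {d} k<t od sd with d ≟ bwd k | d ≟ bwd' k
    ... | yes p | _     = inj₁ p
    ... | no _  | yes p = inj₂ p
    ... | no n  | no n' = ⊥-elim (not-¬ (beside-backward k<t od n n') sd)

    origin-flip-forward : ∀ {k d} → k < t → origin G d ≡ vertex k → side d ≡ c →
                          origin G (flip G d) ≡ vertex (suc k)
    origin-flip-forward k<t od sd with forward-cases k<t od sd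
    ... | inj₁ refl = origin-flip-fwd k<t
    ... | inj₂ refl = origin-flip-fwd' k<t

    origin-flip-backward : ∀ {k d} → k < t → origin G d ≡ vertex (suc k) → side d ≡ not c →
                           origin G (flip G d) ≡ vertex k
    origin-flip-backward k<t od sd with backward-cases k<t od sd
    ... | inj₁ refl = origin-flip-bwd k<t
    ... | inj₂ refl = origin-flip-bwd' k<t

    forward-edge : ∀ {k d e} → k < t → OffChain e → origin G d ≡ vertex k → side d ≡ c → edgeOf G d ≢ e
    forward-edge k<t off od sd with forward-cases k<t od sd
    ... | inj₁ refl = proj₁ (offChain-dartFrom off k<t _)
    ... | inj₂ refl = proj₂ (offChain-dartFrom off k<t _)

    backward-edge : ∀ {k d e} → k < t → OffChain e → origin G d ≡ vertex (suc k) → side d ≡ not c → edgeOf G d ≢ e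
    backward-edge k<t off od sd with backward-cases k<t od sd
    ... | inj₁ refl = proj₁ (offChain-dartFrom off k<t _)
    ... | inj₂ refl = proj₂ (offChain-dartFrom off k<t _)

    beside-first : ∀ {d} → origin G d ≡ vertex 0 → OffChain (edgeOf G d) → side d ≡ not c
    beside-first od off = beside-forward (<⇒≤ 1<t) od (proj₁ (offChain-≢ off (<⇒≤ 1<t) _))
                                                      (proj₂ (offChain-≢ off (<⇒≤ 1<t) _))

    beside-last : ∀ {d} → origin G d ≡ vertex t → OffChain (edgeOf G d) → side d ≡ c
    beside-last od off = beside-backward last<t (trans od (cong vertex (sym t≡1+last)))
                           (proj₁ (offChain-≢ off last<t _)) (proj₂ (offChain-≢ off last<t _))
      where
      t≡1+last : suc (pred t) ≡ t
      t≡1+last = suc-pred t {{>-nonZero (<⇒≤ 1<t)}}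
      last<t : pred t < t
      last<t = subst (pred t <_) t≡1+last ≤-refl

    offChain-first : ∀ {d} → origin G d ≡ vertex 0 → side d ≡ not c → OffChain (edgeOf G d)
    offChain-first {d} od sd {k} k<t = not-edge (edge-joins k<t) (proj₁ (forward-sides k<t)) ,
                                       not-edge (edge'-joins k<t) (proj₂ (forward-sides k<t))
      where
      not-edge : ∀ {e} → Joins G e (vertex k) (vertex (suc k)) → side (dartFrom e (vertex k)) ≡ c → e ≢ edgeOf G d
      not-edge j s refl with dartFrom-cases refl j (vertex≢next k<t)
      ... | inj₁ p = not-¬ s (trans (cong side (sym p)) sd)
      ... | inj₂ p with vertex-injective z≤n k<t
                          (trans (sym od) (trans (cong (origin G) p) (origin-dartFrom (joins-incident₂ j))))
      ...   | ()

    module Zigzag (x¹ : Dart G) (ox⁰ : origin G (flip G x¹) ≡ vertex 0)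
                  (sx⁰ : side (flip G x¹) ≡ not c) where

      strand : ℕ → Dart G
      strand k = flip G (iter G φ k x¹)

      alternate : ℕ → Dart G × Dart G
      alternate zero    = flip G x¹ , rot² (flip G x¹)
      alternate (suc k) = swap (alternate k)

      alternate-even : ∀ q → alternate (q * 2) ≡ alternate 0
      alternate-even zero    = refl
      alternate-even (suc q) = alternate-even q

      -- strand k, the reverse of the k-th dart of the face walk from x¹, lies at vertex k; k
      -- face steps take it and the dart opposite it to the reverse of x¹ and the dart opposite
      -- that, in an order swapping with the parity of k.
      record StrandAt (k : ℕ) : Set where
        field
          at-vertex : origin G (strand k) ≡ vertex k
          on-side   : side (strand k) ≡ not c
          returns   : iter G φ k (strand k) ≡ proj₁ (alternate k)
          returns²  : iter G φ k (rot² (strand k)) ≡ proj₂ (alternate k)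

      rot-strand : ∀ {k} → StrandAt k → origin G (rot R (strand k)) ≡ vertex k × side (rot R (strand k)) ≡ c
      rot-strand s = trans (local R _) (StrandAt.at-vertex s) ,
                     trans (side-rot _) (trans (cong not (StrandAt.on-side s)) (not-involutive c))

      strand-step : ∀ {k} → k < t → StrandAt k → StrandAt (suc k)
      strand-step {k} k<t s = record
        { at-vertex = oL
        ; on-side   = sL
        ; returns   = trans (iter-suc φ k L) (trans (cong (iter G φ k) (φ-flip r)) (StrandAt.returns² s))
        ; returns²  = trans (iter-suc φ k (rot² L)) (trans (cong (iter G φ k) φ-rot²L) (StrandAt.returns s))
        }
        where
        r L : Dart G
        r = rot R (strand k)
        L = flip G r

        oL : origin G L ≡ vertex (suc k)
        oL = origin-flip-forward k<t (proj₁ (rot-strand s)) (proj₂ (rot-strand s))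

        sL : side L ≡ not c
        sL = trans (side-flip r) (cong not (proj₂ (rot-strand s)))

        φ-rot²L : φ (rot² L) ≡ strand k
        s-rot²L : side (rot² L) ≡ not c
        s-rot²L = trans (side-rot² L) sL

        φ-rot²L with DegreeFour.adjacent (degree-vertex (<⇒≤ k<t)) (StrandAt.at-vertex s)
                       (origin-flip-backward k<t (trans (local R _) (trans (local R _) oL)) s-rot²L)
                       (trans (side-flip (rot² L)) (cong not (trans s-rot²L (sym (StrandAt.on-side s)))))
        ... | inj₁ p = ⊥-elim (FourCycle.a≢rot²a (fourCycle (degree-vertex k<t) oL)
                         (trans (cong (flip G) (sym p)) (flip-involutive (rot² L))))
        ... | inj₂ p = p

      strand-at : ∀ {k} → k ≤ t → StrandAt k
      strand-at {zero}  _   = record { at-vertex = ox⁰ ; on-side = sx⁰ ; returns = refl ; returns² = refl }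
      strand-at {suc k} k<t = strand-step k<t (strand-at (<⇒≤ k<t))

      strand-returns : 2 ∣ t → iter G φ t (strand t) ≡ flip G x¹
      strand-returns (divides q t≡2q) =
        trans (StrandAt.returns (strand-at ≤-refl)) (cong proj₁ (trans (cong alternate t≡2q) (alternate-even q)))

      outward-avoids : ∀ {Z} → OffChain Z → edgeOf G x¹ ≢ Z → WalkAvoids Z t x¹
      outward-avoids off nx zero    _   = nx
      outward-avoids off nx (suc k) k<t =
        let (o , s) = rot-strand (strand-at (<⇒≤ k<t)) in forward-edge k<t off o s

      descend : ∀ i {j} → i + suc j ≡ t →
                origin G (iter G φ i (strand t)) ≡ vertex (suc j) × side (iter G φ i (strand t)) ≡ not c
      descend zero    eq = trans (StrandAt.at-vertex (strand-at ≤-refl)) (cong vertex (sym eq)) ,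
                           StrandAt.on-side (strand-at ≤-refl)
      descend (suc i) {j} eq with descend i {suc j} (trans (+-suc i (suc j)) eq)
      ... | o , s = trans (local R _) (origin-flip-backward j+1<t o s) , trans (side-φ _) s
        where
        j+1<t : suc j < t
        j+1<t = subst (suc (suc j) ≤_) eq (s≤s (m≤n+m (suc j) i))

      inward-avoids : 2 ∣ t → ∀ {Z y¹} → OffChain Z → edgeOf G x¹ ≢ Z → edgeOf G y¹ ≢ Z →
                      φ y¹ ≡ strand t → WalkAvoids Z (suc t) y¹
      inward-avoids even {Z} {y¹} off nx ny φy¹ = avoids
        where
        walk : ∀ i → iter G φ (suc i) y¹ ≡ iter G φ i (strand t)
        walk i = trans (iter-suc φ i y¹) (cong (iter G φ i) φy¹)

        avoids : WalkAvoids Z (suc t) y¹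
        avoids zero    _         = ny
        avoids (suc i) (s≤s i≤t) with m≤n⇒∃[o]m+o≡n i≤t
        ... | zero  , i+0≡t = λ e → nx (trans (cong (edgeOf G) (sym (trans (walk i) end))) e)
          where
          end : iter G φ i (strand t) ≡ flip G x¹
          end = trans (cong (λ m → iter G φ m (strand t)) (trans (sym (+-identityʳ i)) i+0≡t)) (strand-returns even)
        ... | suc j , eq = λ e → backward-edge (subst (suc j ≤_) eq (m≤n+m (suc j) i)) off
                                   (proj₁ (descend i eq)) (proj₂ (descend i eq))
                                   (trans (cong (edgeOf G) (sym (walk i))) e)

      returns : 2 ∣ t → ∀ {Z y¹} → OffChain Z → edgeOf G x¹ ≢ Z → edgeOf G y¹ ≢ Z →
                origin G (flip G y¹) ≡ vertex t → side (flip G y¹) ≡ c →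
                (iter G φ (suc t) x¹ ≡ flip G y¹ × WalkAvoids Z (suc t) x¹) ⊎
                (iter G φ (suc t) y¹ ≡ flip G x¹ × WalkAvoids Z (suc t) y¹)
      returns even {Z} {y¹} off nx ny oy sy
        with DegreeFour.adjacent (degree-vertex ≤-refl) (StrandAt.at-vertex (strand-at ≤-refl)) oy
               (trans sy (sym (trans (cong not (StrandAt.on-side (strand-at ≤-refl))) (not-involutive c))))
      ... | inj₁ p = inj₁ (sym p , walkAvoids-extend (outward-avoids off nx)
                                                     (λ e → ny (trans (cong (edgeOf G) p) e)))
      ... | inj₂ p = inj₂ (trans (iter-suc φ t y¹) (trans (cong (iter G φ t) p) (strand-returns even)) ,
                          inward-avoids even off nx ny p)

module Configuration {G : Graph} (R : RotationSystem G) (bi : BiEulerian R) {s t : ℕ} (cf : ConfigF G s t) where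
  open Darts G
  open Rotation R
  open TwoFaces R bi
  open ConfigF cf

  x y : Edge G
  x = proj₁ adjFirst
  y = proj₁ adjLast

  path₁ : DigonPath G s
  path₁ = toDigonPath chain₁ x

  path₂ : DigonPath G t
  path₂ = toDigonPath chain₂ x

  module C₁ = PathDarts path₁
  module C₂ = PathDarts path₂
  module S₁ = ChainSides R bi path₁
  module S₂ = ChainSides R bi path₂
  open C₁ using () renaming (vertex to vertex₁)
  open C₂ using () renaming (vertex to vertex₂)

  apart : ∀ i j → vertex₁ i ≢ vertex₂ j
  apart i j eq with toDigonPath-vertex chain₁ x i | toDigonPath-vertex chain₂ x j
  ... | i' , p | j' , q = disjoint i' j' (trans (sym p) (trans eq q))

  v : Vertex G
  v = vertex₁ s

  x-joins : Joins G x v (vertex₂ 0)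
  x-joins = subst₂ (Joins G x) (sym (toDigonPath-last chain₁ x)) (sym (toDigonPath-first chain₂ x))
                   (proj₂ adjFirst)

  y-joins : Joins G y v (vertex₂ t)
  y-joins = subst₂ (Joins G y) (sym (toDigonPath-last chain₁ x)) (sym (toDigonPath-last chain₂ x))
                   (proj₂ adjLast)

  x¹ y¹ : Dart G
  x¹ = dartFrom x v
  y¹ = dartFrom y v

  origin-x¹ : origin G x¹ ≡ v
  origin-x¹ = origin-dartFrom (joins-incident₁ x-joins)

  origin-y¹ : origin G y¹ ≡ v
  origin-y¹ = origin-dartFrom (joins-incident₁ y-joins)

  origin-flip-x¹ : origin G (flip G x¹) ≡ vertex₂ 0
  origin-flip-x¹ = trans (cong (origin G) (flip-dartFrom x-joins (apart s 0)))
                         (origin-dartFrom (joins-incident₂ x-joins))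

  origin-flip-y¹ : origin G (flip G y¹) ≡ vertex₂ t
  origin-flip-y¹ = trans (cong (origin G) (flip-dartFrom y-joins (apart s t)))
                         (origin-dartFrom (joins-incident₂ y-joins))

  x-off₁ : C₁.OffChain (edgeOf G x¹)
  x-off₁ = C₁.offChain-dart {flip G x¹} origin-flip-x¹ (λ i → apart i 0)

  y-off₁ : C₁.OffChain (edgeOf G y¹)
  y-off₁ = C₁.offChain-dart {flip G y¹} origin-flip-y¹ (λ i → apart i t)

  x-off₂ : C₂.OffChain (edgeOf G x¹)
  x-off₂ = C₂.offChain-dart {x¹} origin-x¹ (λ j eq → apart s j (sym eq))

  y-off₂ : C₂.OffChain (edgeOf G y¹)
  y-off₂ = C₂.offChain-dart {y¹} origin-y¹ (λ j eq → apart s j (sym eq))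

  -- On the first chain x¹ and y¹ both lie beside the last digon, hence on one side; on the
  -- second chain the reverse of x¹ lies beside the first digon and the reverse of y¹ beside
  -- the last, hence on opposite sides.
  long-chains : 1 < s → 1 < t → ⊥
  long-chains 1<s 1<t = not-¬ y-side x-side
    where
    module U₁ = S₁.Uniform 1<s x-off₁
    module U₂ = S₂.Uniform 1<t x-off₂

    x-side : not U₁.c ≡ not U₂.c
    x-side = trans (sym (trans (side-flip x¹) (cong not (U₁.beside-last origin-x¹ x-off₁))))
                   (U₂.beside-first origin-flip-x¹ x-off₂)

    y-side : not U₁.c ≡ U₂.c
    y-side = trans (sym (trans (side-flip y¹) (cong not (U₁.beside-last origin-y¹ y-off₁))))
                   (U₂.beside-last origin-flip-y¹ y-off₂)

  module ShortChain (s≡1 : s ≡ 1) (1<t : 1 < t) where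
    open S₂.Uniform 1<t x-off₂ public

    0<s : 0 < s
    0<s = subst (0 <_) (sym s≡1) (s≤s z≤n)

    0<t : 0 < t
    0<t = <⇒≤ 1<t

    sx⁰ : side (flip G x¹) ≡ not c
    sx⁰ = beside-first origin-flip-x¹ x-off₂

    sy⁰ : side (flip G y¹) ≡ c
    sy⁰ = beside-last origin-flip-y¹ y-off₂

    sx¹ : side x¹ ≡ c
    sx¹ = trans (side-unflip x¹) (trans (cong not sx⁰) (not-involutive c))

    sy¹ : side y¹ ≡ not c
    sy¹ = trans (side-unflip y¹) (cong not sy⁰)

    z⁰ : Dart G
    z⁰ = rot² (flip G x¹)

    origin-z⁰ : origin G z⁰ ≡ vertex₂ 0
    origin-z⁰ = trans (local R _) (trans (local R _) origin-flip-x¹)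

    z-off₁ : C₁.OffChain (edgeOf G z⁰)
    z-off₁ = C₁.offChain-dart {z⁰} origin-z⁰ (λ i → apart i 0)

    z-off₂ : C₂.OffChain (edgeOf G z⁰)
    z-off₂ = offChain-first origin-z⁰ (trans (side-rot² _) sx⁰)

    x≢z : edgeOf G x¹ ≢ edgeOf G z⁰
    x≢z eq with same-edge {x¹} {z⁰} (sym eq)
    ... | inj₁ z⁰≡x¹ = apart s 0 (trans (sym origin-x¹) (trans (cong (origin G) (sym z⁰≡x¹)) origin-z⁰))
    ... | inj₂ z⁰≡x⁰ = FourCycle.a≢rot²a (fourCycle (C₂.degree-vertex z≤n) origin-flip-x¹) (sym z⁰≡x⁰)

    y≢z : edgeOf G y¹ ≢ edgeOf G z⁰
    y≢z eq with same-edge {y¹} {z⁰} (sym eq)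
    ... | inj₁ z⁰≡y¹ = apart s 0 (trans (sym origin-y¹) (trans (cong (origin G) (sym z⁰≡y¹)) origin-z⁰))
    ... | inj₂ z⁰≡y⁰ = <⇒≢ 0<t (C₂.vertex-injective z≤n ≤-refl
                         (trans (sym origin-z⁰) (trans (cong (origin G) z⁰≡y⁰) origin-flip-y¹)))

    x¹≢y¹ : x¹ ≢ y¹
    x¹≢y¹ eq = <⇒≢ 0<t (C₂.vertex-injective z≤n ≤-refl
                 (trans (sym origin-flip-x¹) (trans (cong (λ d → origin G (flip G d)) eq) origin-flip-y¹)))

    darts-at-v : Unique (x¹ ∷ y¹ ∷ C₁.bwd 0 ∷ C₁.bwd' 0 ∷ [])
    darts-at-v = (x¹≢y¹ ∷ proj₁ (C₁.offChain-≢ x-off₁ 0<s _) ∷ proj₂ (C₁.offChain-≢ x-off₁ 0<s _) ∷ []) ∷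
                 (proj₁ (C₁.offChain-≢ y-off₁ 0<s _) ∷ proj₂ (C₁.offChain-≢ y-off₁ 0<s _) ∷ []) ∷
                 (C₁.bwd≢bwd' 0<s ∷ []) ∷ [] ∷ []

    no-return : ∀ {P Q n} → Unique (P ∷ Q ∷ C₁.bwd 0 ∷ C₁.bwd' 0 ∷ []) → origin G P ≡ v → origin G Q ≡ v →
                side Q ≡ not (side P) → iter G φ n P ≡ flip G Q → WalkAvoids (edgeOf G z⁰) n P → ⊥
    no-return u oP oQ sQ walk avoids =
      no-avoiding-return (C₁.degree-vertex ≤-refl) (C₁.degree-vertex z≤n) u
        (oP ∷ oQ ∷ trans (C₁.origin-bwd 0<s) at-v ∷ trans (C₁.origin-bwd' 0<s) at-v ∷ [])
        (C₁.origin-flip-bwd 0<s) (C₁.origin-flip-bwd' 0<s) sQ walk avoids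
        (proj₁ (C₁.offChain-dartFrom z-off₁ 0<s _)) (proj₂ (C₁.offChain-dartFrom z-off₁ 0<s _))
      where
      at-v : vertex₁ 1 ≡ v
      at-v = cong vertex₁ (sym s≡1)

  short-chain : s ≡ 1 → 2 ∣ t → 1 < t → ⊥
  short-chain s≡1 even 1<t =
    [ (λ (walk , avoids) → no-return darts-at-v origin-x¹ origin-y¹ y-x-side walk avoids)
    , (λ (walk , avoids) → no-return (Unique-swap darts-at-v) origin-y¹ origin-x¹ x-y-side walk avoids)
    ]′ (Zigzag.returns x¹ origin-flip-x¹ sx⁰ even z-off₂ x≢z y≢z origin-flip-y¹ sy⁰)
    where
    open ShortChain s≡1 1<t

    y-x-side : side y¹ ≡ not (side x¹)
    y-x-side = trans sy¹ (cong not (sym sx¹))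

    x-y-side : side x¹ ≡ not (side y¹)
    x-y-side = trans sx¹ (sym (trans (cong not sy¹) (not-involutive c)))

proposition3p7 : (G : Graph) → Eulerian G → (s t : ℕ) →
    ((s ≡ 1 × 2 ∣ t × 2 ≤ t) ⊎ (2 ≤ s × 2 ≤ t)) →
    ConfigF G s t →
    ¬ HasOrientableBiEulerianEmbedding G
proposition3p7 G _ s t (inj₁ (s≡1 , even , 1<t)) cf (R , bi) = Configuration.short-chain R bi cf s≡1 even 1<t
proposition3p7 G _ s t (inj₂ (1<s , 1<t))        cf (R , bi) = Configuration.long-chains R bi cf 1<s 1<t
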